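{- Let $G$ be a connected graph and let $x,y$ be vertices with $d(x,y)=2$. If $a,b$ are vertices with $d(a,x)=d(a,y)+d(y,x)$ and $d(b,y)=d(b,x)+d(x,y)$, then every path $P$ between $a$ and $b$ all of whose vertices lie in $\overline{xy}^G$ contains $x$, $y$ and some vertex $c'\in N_G(x)\cap N_G(y)$.
   Context: Graphs are finite and simple; $d$ is the shortest-path distance and $N_G(v)$ the neighborhood of $v$. For distinct vertices $x,y$, $\overline{xy}^G=\{z: d(x,y)=d(x,z)+d(z,y)\ \text{or}\ d(x,y)=|d(x,z)-d(z,y)|\}$. -}

module Defs where

open import Data.Nat using (ℕ; zero; suc; _≤_; ∣_-_∣; _+_)
open import Data.Fin using (Fin)
open import Data.List using (List; []; _∷_)
open import Data.List.Relation.Unary.Unique.Propositional using (Unique)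
open import Data.Product using (Σ; _×_)
open import Data.Sum using (_⊎_)
open import Relation.Binary.PropositionalEquality using (_≡_)
open import Relation.Nullary using (¬_)

record SimpleGraph (n : ℕ) : Set₁ where
  field
    Adj   : Fin n → Fin n → Set
    sym   : ∀ {u v} → Adj u v → Adj v u
    irrefl : ∀ {u} → ¬ Adj u u
open SimpleGraph public

module _ {n : ℕ} (G : SimpleGraph n) where

  data Walk : Fin n → Fin n → Set where
    nil  : ∀ {u} → Walk u u
    cons : ∀ {u v w} → Adj G u v → Walk v w → Walk u w

  walkLength : ∀ {u v} → Walk u v → ℕ
  walkLength nil = 0
  walkLength (cons _ p) = suc (walkLength p)

  vertices : ∀ {u v} → Walk u v → List (Fin n)
  vertices {u} nil = u ∷ []
  vertices {u} (cons _ p) = u ∷ vertices p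

  IsPath : ∀ {u v} → Walk u v → Set
  IsPath p = Unique (vertices p)

  Connected : Set
  Connected = ∀ u v → Walk u v

  record IsDistance (d : Fin n → Fin n → ℕ) : Set where
    field
      realised : ∀ u v → Σ (Walk u v) (λ p → walkLength p ≡ d u v)
      minimal  : ∀ {u v} (p : Walk u v) → d u v ≤ walkLength p

  N : Fin n → Fin n → Set
  N v w = Adj G v w

Interval : ∀ {n} → (Fin n → Fin n → ℕ) → Fin n → Fin n → Fin n → Set
Interval d x y z = (d x y ≡ d x z + d z y) ⊎ (d x y ≡ ∣ d x z - d z y ∣)

module Submission where

-- Let d(x,y) = 2. Every vertex z of the interval \overline{xy} lies on one of
-- three "sides", according to the pair (d(x,z), d(z,y)):
--   BeyondY : d(x,z) = d(z,y) + 2   (y lies between x and z; a is such a vertex),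
--   Common  : d(x,z) = d(z,y) = 1   (z is a common neighbour of x and y),
--   BeyondX : d(z,y) = d(x,z) + 2   (x lies between z and y; b is such a vertex).
-- Along an edge both d(x,·) and d(·,y) change by at most one, so an edge cannot
-- join BeyondY to BeyondX, an edge from BeyondY to Common must start at y, and
-- an edge from Common to BeyondX must end at x.
-- A walk from a to b inside the interval must leave BeyondY somewhere and enter
-- BeyondX somewhere (the "crossing" lemma for walks); the first crossing yields
-- y and a common neighbour of x and y on the walk, the second yields x.

open import Defs
open import Data.Nat using (ℕ)
open import Data.Fin using (Fin)
open import Data.Nat using (_+_)
open import Data.List.Relation.Unary.All using (All)
open import Data.List.Membership.Propositional using (_∈_)
open import Data.Product using (_×_; ∃)
open import Relation.Binary.PropositionalEquality using (_≡_; _≢_)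

open import Data.Nat using (zero; suc; _≤_; _≰_; s≤s; ∣_-_∣)
open import Data.Nat.Properties
  using (≤-antisym; ≤-reflexive; +-suc; +-identityʳ; +-assoc; +-cancelʳ-≤; n≤0⇒n≡0;
         m+n≤o⇒n≤o; m+1+n≢m)
open import Data.List.Relation.Unary.All using (_∷_)
import Data.List.Relation.Unary.All as All
open import Data.List.Relation.Unary.Any using (here; there)
open import Data.Product using (_,_)
open import Data.Sum using (_⊎_; inj₁; inj₂; assocˡ)
open import Data.Empty using (⊥; ⊥-elim)
open import Relation.Nullary using (¬_)
open import Relation.Binary.PropositionalEquality
  using (refl; cong; subst; subst₂; trans) renaming (sym to ≡-sym)

∣-∣≡⇒ : ∀ p q {k} → ∣ p - q ∣ ≡ k → p ≡ q + k ⊎ q ≡ p + k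
∣-∣≡⇒ zero    q       e = inj₂ e
∣-∣≡⇒ (suc p) zero    e = inj₁ e
∣-∣≡⇒ (suc p) (suc q) e with ∣-∣≡⇒ p q e
... | inj₁ p≡q+k = inj₁ (cong suc p≡q+k)
... | inj₂ q≡p+k = inj₂ (cong suc q≡p+k)

+≡2⇒ : ∀ p q → 2 ≡ p + q → p ≡ q + 2 ⊎ (p ≡ 1 × q ≡ 1) ⊎ q ≡ p + 2
+≡2⇒ zero                q    refl = inj₂ (inj₂ refl)
+≡2⇒ (suc zero)          q    refl = inj₂ (inj₁ (refl , refl))
+≡2⇒ (suc (suc zero))    zero refl = inj₁ refl

+2≰1 : ∀ q → q + 2 ≰ 1
+2≰1 q q+2≤1 with m+n≤o⇒n≤o q q+2≤1
... | s≤s ()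

+2≤2⇒≡0 : ∀ q → q + 2 ≤ 2 → q ≡ 0
+2≤2⇒≡0 q q+2≤2 = n≤0⇒n≡0 (+-cancelʳ-≤ 2 q 0 q+2≤2)

¬mutual-lead : ∀ p q → p ≡ q + 2 → q ≡ p + 2 → ⊥
¬mutual-lead p q p≡q+2 q≡p+2 =
  m+1+n≢m p (≡-sym (trans p≡q+2 (trans (cong (_+ 2) q≡p+2) (+-assoc p 2 2))))

¬mutual-lead≤ : ∀ p q → p + 2 ≤ suc q → q + 2 ≤ suc p → ⊥
¬mutual-lead≤ zero    q       _           q+2≤1       = +2≰1 q q+2≤1
¬mutual-lead≤ (suc p) zero    p+3≤1       _           = +2≰1 (suc p) p+3≤1
¬mutual-lead≤ (suc p) (suc q) (s≤s h) (s≤s h') = ¬mutual-lead≤ p q h h'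

module Walks {n : ℕ} (G : SimpleGraph n) where

  reverseOnto : ∀ {u v w} → Walk G u v → Walk G u w → Walk G v w
  reverseOnto nil        q = q
  reverseOnto (cons e p) q = reverseOnto p (cons (sym G e) q)

  length-reverseOnto : ∀ {u v w} (p : Walk G u v) (q : Walk G u w) →
                       walkLength G (reverseOnto p q) ≡ walkLength G p + walkLength G q
  length-reverseOnto nil        q = refl
  length-reverseOnto (cons e p) q =
    trans (length-reverseOnto p (cons (sym G e) q)) (+-suc (walkLength G p) (walkLength G q))

  reverse : ∀ {u v} → Walk G u v → Walk G v u
  reverse p = reverseOnto p nil

  length-reverse : ∀ {u v} (p : Walk G u v) → walkLength G (reverse p) ≡ walkLength G p
  length-reverse p = trans (length-reverseOnto p nil) (+-identityʳ (walkLength G p))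

  start∈ : ∀ {u v} (p : Walk G u v) → u ∈ vertices G p
  start∈ nil        = here refl
  start∈ (cons _ _) = here refl

  start-satisfies : ∀ {ℓ} {P : Fin n → Set ℓ} {u v} (p : Walk G u v) →
                    All P (vertices G p) → P u
  start-satisfies nil        (pu ∷ _) = pu
  start-satisfies (cons _ _) (pu ∷ _) = pu

  record Crossing (A B : Fin n → Set) {u v} (p : Walk G u v) : Set where
    constructor crossingAt
    field
      {from to} : Fin n
      from∈     : from ∈ vertices G p
      to∈       : to ∈ vertices G p
      edge      : Adj G from to
      fromA     : A from
      toB       : B to

  extend : ∀ {A B : Fin n → Set} {u v w} (e : Adj G u v) {p : Walk G v w} →
           Crossing A B p → Crossing A B (cons e p)
  extend e (crossingAt f∈ t∈ edge fa tb) = crossingAt (there f∈) (there t∈) edge fa tb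

  crossing : ∀ {A B : Fin n → Set} {u v} (p : Walk G u v) →
             All (λ z → A z ⊎ B z) (vertices G p) → A u → ¬ A v → Crossing A B p
  crossing nil _ au ¬av = ⊥-elim (¬av au)
  crossing (cons e p) (_ ∷ sides) au ¬av with start-satisfies p sides
  ... | inj₁ aw = extend e (crossing p sides aw ¬av)
  ... | inj₂ bw = crossingAt (here refl) (there (start∈ p)) e au bw

module Distance {n : ℕ} {G : SimpleGraph n} {d : Fin n → Fin n → ℕ}
                (D : IsDistance G d) where
  open IsDistance D
  open Walks G

  -- d is symmetric, since walks can be reversed.
  dist-sym≤ : ∀ u v → d v u ≤ d u v
  dist-sym≤ u v with realised u v
  ... | p , len≡d = subst (d v u ≤_) (trans (length-reverse p) len≡d) (minimal (reverse p))

  dist-sym : ∀ u v → d u v ≡ d v u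
  dist-sym u v = ≤-antisym (dist-sym≤ v u) (dist-sym≤ u v)

  dist-zero : ∀ {u v} → d u v ≡ 0 → u ≡ v
  dist-zero {u} {v} d≡0 with realised u v
  ... | nil      , _      = refl
  ... | cons _ _ , len≡d with trans len≡d d≡0
  ...   | ()

  dist-one : ∀ {u v} → d u v ≡ 1 → Adj G u v
  dist-one {u} {v} d≡1 with realised u v
  ... | cons e nil , _ = e
  ... | nil , len≡d with trans len≡d d≡1
  ...   | ()
  dist-one {u} {v} d≡1 | cons _ (cons _ _) , len≡d with trans len≡d d≡1
  ...   | ()

  step-to : ∀ w {u v} → Adj G u v → d v w ≤ suc (d u w)
  step-to w {u} {v} e with realised u w
  ... | p , len≡d = subst (d v w ≤_) (cong suc len≡d) (minimal (cons (sym G e) p))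

  step-from : ∀ w {u v} → Adj G u v → d w v ≤ suc (d w u)
  step-from w {u} {v} e =
    subst₂ (λ k l → k ≤ suc l) (dist-sym v w) (dist-sym u w) (step-to w e)

module IntervalAtDistanceTwo {n : ℕ} {G : SimpleGraph n} {d : Fin n → Fin n → ℕ}
                             (D : IsDistance G d) (x y : Fin n) (d≡2 : d x y ≡ 2) where
  open Distance D

  BeyondY Common BeyondX : Fin n → Set
  BeyondY z = d x z ≡ d z y + 2
  Common  z = d x z ≡ 1 × d z y ≡ 1
  BeyondX z = d z y ≡ d x z + 2

  classify : ∀ {z} → Interval d x y z → BeyondY z ⊎ Common z ⊎ BeyondX z
  classify {z} (inj₁ sum) = +≡2⇒ (d x z) (d z y) (trans (≡-sym d≡2) sum)
  classify {z} (inj₂ dif) with ∣-∣≡⇒ (d x z) (d z y) (trans (≡-sym dif) d≡2)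
  ... | inj₁ beyondY = inj₁ beyondY
  ... | inj₂ beyondX = inj₂ (inj₂ beyondX)

  common-neighbour : ∀ {z} → Common z → N G x z × N G y z
  common-neighbour {z} (dxz≡1 , dzy≡1) =
    dist-one dxz≡1 , dist-one (trans (dist-sym y z) dzy≡1)

  beyondX⇒¬beyondY : ∀ {z} → BeyondX z → ¬ BeyondY z
  beyondX⇒¬beyondY {z} bx by = ¬mutual-lead (d x z) (d z y) by bx

  beyondX⇒¬common : ∀ {z} → BeyondX z → ¬ Common z
  beyondX⇒¬common {z} bx (_ , dzy≡1) = +2≰1 (d x z) (≤-reflexive (trans (≡-sym bx) dzy≡1))

  beyondY-beyondX : ∀ {u v} → Adj G u v → BeyondY u → ¬ BeyondX v
  beyondY-beyondX {u} {v} e by bx =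
    ¬mutual-lead≤ (d u y) (d x v)
      (subst (_≤ suc (d x v)) by (step-from x (sym G e)))
      (subst (_≤ suc (d u y)) bx (step-to y e))

  beyondY-common : ∀ {u v} → Adj G u v → BeyondY u → Common v → u ≡ y
  beyondY-common {u} {v} e by (dxv≡1 , _) =
    dist-zero (+2≤2⇒≡0 (d u y)
      (subst (_≤ 2) by (subst (λ k → d x u ≤ suc k) dxv≡1 (step-from x (sym G e)))))

  common-beyondX : ∀ {u v} → Adj G u v → Common u → BeyondX v → v ≡ x
  common-beyondX {u} {v} e (_ , duy≡1) bx =
    ≡-sym (dist-zero (+2≤2⇒≡0 (d x v)
      (subst (_≤ 2) bx (subst (λ k → d v y ≤ suc k) duy≡1 (step-to y e)))))

  open Walks G

  module _ {a b : Fin n} (P : Walk G a b) (inside : All (Interval d x y) (vertices G P))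
           (a-beyondY : BeyondY a) (b-beyondX : BeyondX b) where

    sides : All (λ z → BeyondY z ⊎ Common z ⊎ BeyondX z) (vertices G P)
    sides = All.map classify inside

    y-and-common-neighbour-on-walk :
      (y ∈ vertices G P) × ∃ (λ c → N G x c × N G y c × c ∈ vertices G P)
    y-and-common-neighbour-on-walk
      with crossing P sides a-beyondY (beyondX⇒¬beyondY b-beyondX)
    ... | crossingAt _ _ e by (inj₂ bx) = ⊥-elim (beyondY-beyondX e by bx)
    ... | crossingAt u∈ c∈ e by (inj₁ common) with common-neighbour common
    ...   | xc , yc = subst (_∈ vertices G P) (beyondY-common e by common) u∈ , _ , xc , yc , c∈

    x-on-walk : x ∈ vertices G P
    x-on-walk with crossing P (All.map assocˡ sides) (inj₁ a-beyondY) b-outside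
      where
        b-outside : ¬ (BeyondY b ⊎ Common b)
        b-outside (inj₁ by) = beyondX⇒¬beyondY b-beyondX by
        b-outside (inj₂ cb) = beyondX⇒¬common b-beyondX cb
    ... | crossingAt _ _ e (inj₁ by) bx = ⊥-elim (beyondY-beyondX e by bx)
    ... | crossingAt _ v∈ e (inj₂ common) bx = subst (_∈ vertices G P) (common-beyondX e common bx) v∈

lemma1 : ∀ {n} (G : SimpleGraph n) → Connected G
    → (d : Fin n → Fin n → ℕ) → IsDistance G d
    → (x y : Fin n) → d x y ≡ 2
    → (a b : Fin n) → d a x ≡ d a y + d y x → d b y ≡ d b x + d x y
    → (P : Walk G a b) → IsPath G P
    → All (Interval d x y) (vertices G P)
    → (x ∈ vertices G P) × (y ∈ vertices G P)
    × ∃ (λ c → N G x c × N G y c × c ∈ vertices G P)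
lemma1 G _ d D x y d≡2 a b a-beyond b-beyond P _ inside =
  x-on-walk P inside a-beyondY b-beyondX , y-and-common-neighbour-on-walk P inside a-beyondY b-beyondX
  where
    open Distance D
    open IntervalAtDistanceTwo D x y d≡2

    -- d(x,a) = d(a,x) = d(a,y) + d(y,x) = d(a,y) + 2
    a-beyondY : BeyondY a
    a-beyondY = trans (dist-sym x a) (trans a-beyond (cong (d a y +_) (trans (dist-sym y x) d≡2)))

    -- d(b,y) = d(b,x) + d(x,y) = d(x,b) + 2
    b-beyondX : BeyondX b
    b-beyondX = trans b-beyond (trans (cong (_+ d x y) (dist-sym b x)) (cong (d x b +_) d≡2))
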